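{- Let $k$ and $m$ be positive integers such that $\gcd(k,m)=1$ and $m<k<\sigma(m)$. If a positive integer $n$ has abundancy index $\frac{\sigma(n)}{n}=\frac{k}{k-m}$, then $n$ is not amicable with any other positive integer; that is, there is no positive integer $l\neq n$ with $n+l=\sigma(n)=\sigma(l)$.
   Context: For a positive integer $n$, $\sigma(n)$ denotes the sum of all positive divisors of $n$ (including $n$). Two positive integers $m,n$ are called amicable if $m+n=\sigma(m)=\sigma(n)$. -}

module Defs where

open import Data.Nat using (ℕ; suc; _+_)
open import Data.Nat.Divisibility using (_∣?_)
open import Data.Nat.ListAction using (sum)
open import Data.List using (filter; upTo; map)
open import Data.Product using (_×_)
open import Relation.Binary.PropositionalEquality using (_≡_)

σ : ℕ → ℕ
σ n = sum (filter (λ d → d ∣? n) (map suc (upTo n)))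

Amicable : ℕ → ℕ → Set
Amicable m n = (m + n ≡ σ m) × (σ m ≡ σ n)

-- Write s = σ n. From n + l = s and s (k − m) = k n one gets k l = m s, so the coprimality
-- of k and m forces s = t k and l = t m for some t, with t ≠ 0 because l ≠ 0. Each divisor d
-- of m gives the divisor t d of t m, hence σ l = σ (t m) ≥ t σ m > t k = σ n, contradicting
-- σ l = σ n.
module Submission where

open import Defs
open import Data.Nat using (ℕ; zero; suc; _+_; _*_; _∸_; _≤_; _<_; z≤n; NonZero; ≢-nonZero⁻¹)
open import Data.Nat.Properties
open import Data.Nat.GCD using (gcd)
open import Data.Nat.Coprimality using (gcd≡1⇒coprime; coprime-divisor)
open import Data.Nat.Divisibility using (_∣?_; divides; *-monoˡ-∣)
open import Data.Nat.ListAction using (sum)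
open import Data.Nat.ListAction.Properties using (sum-++)
open import Data.List using (filter; upTo; map; _++_; [_])
open import Data.List.Properties using (upTo-∷ʳ; map-++; filter-++)
open import Data.Product using (∃; _×_; _,_)
open import Data.Empty using (⊥-elim)
open import Relation.Nullary using (¬_; yes; no)
open import Relation.Binary.PropositionalEquality
  using (_≡_; _≢_; refl; sym; trans; cong; module ≡-Reasoning)

-- The divisors of x in [1, N] summed; σ x is σ≤ x x definitionally.
σ≤ : ℕ → ℕ → ℕ
σ≤ x N = sum (filter (_∣? x) (map suc (upTo N)))

divisorOrZero : ℕ → ℕ → ℕ
divisorOrZero x d with d ∣? x
... | yes _ = d
... | no  _ = 0

σ≤-suc : ∀ x N → σ≤ x (suc N) ≡ σ≤ x N + divisorOrZero x (suc N)
σ≤-suc x N = begin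
  sum (filter (_∣? x) (map suc (upTo (suc N))))
    ≡⟨ cong (λ ds → sum (filter (_∣? x) (map suc ds))) (sym (upTo-∷ʳ N)) ⟩
  sum (filter (_∣? x) (map suc (upTo N ++ [ N ])))
    ≡⟨ cong (λ ds → sum (filter (_∣? x) ds)) (map-++ suc (upTo N) [ N ]) ⟩
  sum (filter (_∣? x) (map suc (upTo N) ++ [ suc N ]))
    ≡⟨ cong sum (filter-++ (_∣? x) (map suc (upTo N)) [ suc N ]) ⟩
  sum (filter (_∣? x) (map suc (upTo N)) ++ filter (_∣? x) [ suc N ])
    ≡⟨ sum-++ (filter (_∣? x) (map suc (upTo N))) (filter (_∣? x) [ suc N ]) ⟩
  σ≤ x N + sum (filter (_∣? x) [ suc N ])
    ≡⟨ cong (σ≤ x N +_) (sum-filter-[ suc N ]) ⟩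
  σ≤ x N + divisorOrZero x (suc N) ∎
  where
  open ≡-Reasoning
  sum-filter-[_] : ∀ d → sum (filter (_∣? x) [ d ]) ≡ divisorOrZero x d
  sum-filter-[ d ] with d ∣? x
  ... | yes _ = +-identityʳ d
  ... | no  _ = refl

σ≤-mono-+ : ∀ x j N → σ≤ x N ≤ σ≤ x (j + N)
σ≤-mono-+ x zero    N = ≤-refl
σ≤-mono-+ x (suc j) N = begin
  σ≤ x N                                      ≤⟨ σ≤-mono-+ x j N ⟩
  σ≤ x (j + N)                                ≤⟨ m≤m+n (σ≤ x (j + N)) _ ⟩
  σ≤ x (j + N) + divisorOrZero x (suc j + N)  ≡⟨ sym (σ≤-suc x (j + N)) ⟩
  σ≤ x (suc j + N)                            ∎
  where open ≤-Reasoning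

*-divisorOrZero : ∀ t x d → t * divisorOrZero x d ≤ divisorOrZero (x * t) (d * t)
*-divisorOrZero t x d with d ∣? x | (d * t) ∣? (x * t)
... | yes _   | yes _       = ≤-reflexive (*-comm t d)
... | yes d∣x | no  d*t∤x*t = ⊥-elim (d*t∤x*t (*-monoˡ-∣ t d∣x))
... | no  _   | _           = ≤-trans (≤-reflexive (*-zeroʳ t)) z≤n

*-σ≤ : ∀ t′ x N → suc t′ * σ≤ x N ≤ σ≤ (x * suc t′) (N * suc t′)
*-σ≤ t′ x zero    = ≤-reflexive (*-zeroʳ t′)
*-σ≤ t′ x (suc N) = begin
  t * σ≤ x (suc N)
    ≡⟨ cong (t *_) (σ≤-suc x N) ⟩
  t * (σ≤ x N + divisorOrZero x (suc N))
    ≡⟨ *-distribˡ-+ t (σ≤ x N) (divisorOrZero x (suc N)) ⟩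
  t * σ≤ x N + t * divisorOrZero x (suc N)
    ≤⟨ +-mono-≤ (≤-trans (*-σ≤ t′ x N) (σ≤-mono-+ (x * t) t′ (N * t)))
                (*-divisorOrZero t x (suc N)) ⟩
  σ≤ (x * t) (t′ + N * t) + divisorOrZero (x * t) (suc N * t)
    ≡⟨ sym (σ≤-suc (x * t) (t′ + N * t)) ⟩
  σ≤ (x * t) (suc N * t) ∎
  where
  open ≤-Reasoning
  t = suc t′

*-σ≤σ-* : ∀ t x → t * σ x ≤ σ (t * x)
*-σ≤σ-* zero      x = z≤n
*-σ≤σ-* (suc t′) x = ≤-trans (*-σ≤ t′ x x) (≤-reflexive (cong σ (*-comm x (suc t′))))

complement-ratio : ∀ {k m n l s} → m ≤ k → s * (k ∸ m) ≡ k * n → n + l ≡ s → k * l ≡ m * s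
complement-ratio {k} {m} {n} {l} {s} m≤k s*[k∸m]≡k*n n+l≡s =
  trans (+-cancelˡ-≡ (k * n) (k * l) (s * m) k*n+k*l≡k*n+s*m) (*-comm s m)
  where
  open ≡-Reasoning
  k*n+k*l≡k*n+s*m : k * n + k * l ≡ k * n + s * m
  k*n+k*l≡k*n+s*m = begin
    k * n + k * l            ≡⟨ sym (*-distribˡ-+ k n l) ⟩
    k * (n + l)              ≡⟨ cong (k *_) n+l≡s ⟩
    k * s                    ≡⟨ *-comm k s ⟩
    s * k                    ≡⟨ cong (s *_) (sym (m∸n+n≡m m≤k)) ⟩
    s * ((k ∸ m) + m)        ≡⟨ *-distribˡ-+ s (k ∸ m) m ⟩
    s * (k ∸ m) + s * m      ≡⟨ cong (_+ s * m) s*[k∸m]≡k*n ⟩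
    k * n + s * m            ∎

coprime-cross-multiple : ∀ {k m l s} .{{_ : NonZero k}} → gcd k m ≡ 1 → k * l ≡ m * s →
                         ∃ λ t → s ≡ t * k × l ≡ t * m
coprime-cross-multiple {k} {m} {l} {s} gcd≡1 k*l≡m*s
  with coprime-divisor (gcd≡1⇒coprime gcd≡1) (divides l (trans (sym k*l≡m*s) (*-comm k l)))
... | divides t s≡t*k = t , s≡t*k , *-cancelˡ-≡ l (t * m) k (begin
  k * l        ≡⟨ k*l≡m*s ⟩
  m * s        ≡⟨ cong (m *_) s≡t*k ⟩
  m * (t * k)  ≡⟨ cong (m *_) (*-comm t k) ⟩
  m * (k * t)  ≡⟨ sym (*-assoc m k t) ⟩
  m * k * t    ≡⟨ cong (_* t) (*-comm m k) ⟩
  k * m * t    ≡⟨ *-assoc k m t ⟩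
  k * (m * t)  ≡⟨ cong (k *_) (*-comm m t) ⟩
  k * (t * m)  ∎)
  where open ≡-Reasoning

-- The hypothesis l ≢ n is unused: the argument also rules out l = n.
corollary8p2 : (k m : ℕ) → .{{NonZero k}} → .{{NonZero m}} →
               gcd k m ≡ 1 → m < k → k < σ m →
               (n : ℕ) → .{{NonZero n}} →
               σ n * (k ∸ m) ≡ k * n →
               (l : ℕ) → .{{NonZero l}} → l ≢ n → ¬ Amicable n l
corollary8p2 k m gcd≡1 m<k k<σm n abundancy l _ (n+l≡σn , σn≡σl)
  with coprime-cross-multiple gcd≡1 (complement-ratio (<⇒≤ m<k) abundancy n+l≡σn)
... | zero , _ , l≡0 = ≢-nonZero⁻¹ l l≡0
... | t@(suc _) , σn≡t*k , l≡t*m = <-irrefl σn≡σl (begin-strict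
  σ n        ≡⟨ σn≡t*k ⟩
  t * k      <⟨ *-monoʳ-< t k<σm ⟩
  t * σ m    ≤⟨ *-σ≤σ-* t m ⟩
  σ (t * m)  ≡⟨ cong σ (sym l≡t*m) ⟩
  σ l        ∎)
  where open ≤-Reasoning
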